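{- Consider an instance $I$ of the following problem: $n$ jobs $J_1,\ldots,J_n$ with processing times $p_j\ge0$ and rejection penalties $e_j\ge0$, $m$ identical machines ($m$ a fixed constant), and a bound $U\ge0$; a feasible solution accepts a set $A$ and rejects the rest $R$ with $\sum_{J_j\in A}p_j\le U$, assigns each accepted job to a machine, and has cost $C_{\max}(A)+\sum_{J_j\in R}e_j$, where $C_{\max}(A)$ is the maximum machine load. Assume the optimal cost satisfies $\frac12\le Z^*(I)\le1$. Let $\epsilon\in(0,1)$ with $1/\epsilon$ an integer, $\Delta=\frac{\epsilon}{4m+12}$, $\delta=\frac{\epsilon\Delta}{2}$. A job is risky if $e_j\ge\Delta$. Let $I'$ be obtained from $I$ by rounding the rejection penalty of each risky job up to the least multiple of $\delta$ that is at least it. Let $\pi'$ be a feasible solution for $I'$ whose cost in $I'$ is at most $(1+\frac\epsilon2)Z^*(I)$, and let $L$ be the set of risky jobs accepted in $\pi'$ whose processing time is at least $\Delta$. Then $|L|\le(1+\frac\epsilon2)\frac m\Delta$.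
   Context: The jobs in $L$ are called large (accepted risky) jobs. -}

module Defs where

open import Data.Nat as ℕ using (ℕ; zero; suc)
open import Data.Bool using (Bool; true; false; if_then_else_)
open import Data.Fin using (Fin; zero; suc)
open import Data.Integer using (ℤ)
open import Data.Rational
open import Data.Product using (Σ; _×_)
open import Relation.Binary.PropositionalEquality using (_≡_)

sumFin : ∀ {n} → (Fin n → ℚ) → ℚ
sumFin {zero}  f = 0ℚ
sumFin {suc n} f = f zero + sumFin (λ i → f (suc i))

-- maximum of f over Fin n (0 for n = 0; loads are ≥ 0 anyway)
maxFin : ∀ {n} → (Fin n → ℚ) → ℚ
maxFin {zero}  f = 0ℚ
maxFin {suc n} f = f zero ⊔ maxFin (λ i → f (suc i))

countFin : ∀ {n} → (Fin n → Bool) → ℕ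
countFin {zero}  b = 0
countFin {suc n} b = (if b zero then 1 else 0) ℕ.+ countFin (λ i → b (suc i))

_==_ : ∀ {m} → Fin m → Fin m → Bool
zero  == zero  = true
zero  == suc _ = false
suc _ == zero  = false
suc i == suc j = i == j

record Instance (n m : ℕ) : Set where
  field
    p : Fin n → ℚ
    e : Fin n → ℚ
    U : ℚ

-- a solution: accepted set (accept j = true means J_j ∈ A) and machine assignment
-- (the assignment of rejected jobs is irrelevant)
record Solution (n m : ℕ) : Set where
  field
    accept : Fin n → Bool
    assign : Fin n → Fin m

module _ {n m : ℕ} (I : Instance n m) (σ : Solution n m) where
  open Instance I
  open Solution σ

  load : Fin m → ℚ
  load i = sumFin (λ j → if accept j then (if assign j == i then p j else 0ℚ) else 0ℚ)

  Cmax : ℚ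
  Cmax = maxFin load

  acceptedSize : ℚ
  acceptedSize = sumFin (λ j → if accept j then p j else 0ℚ)

  rejectionCost : ℚ
  rejectionCost = sumFin (λ j → if accept j then 0ℚ else e j)

  Feasible : Set
  Feasible = acceptedSize ≤ U

  cost : ℚ
  cost = Cmax + rejectionCost

IsOptimalCost : ∀ {n m} → Instance n m → ℚ → Set
IsOptimalCost {n} {m} I Z =
  Σ (Solution n m) (λ σ → Feasible I σ × cost I σ ≡ Z)
  × ((σ : Solution n m) → Feasible I σ → Z ≤ cost I σ)

IsRoundUp : ℚ → ℚ → ℚ → Set
IsRoundUp δ e e' = Σ ℤ (λ z → e' ≡ (z / 1) * δ) × (e ≤ e') × (e' - δ < e)

withPenalties : ∀ {n m} → Instance n m → (Fin n → ℚ) → Instance n m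
withPenalties I e' = record { p = Instance.p I ; e = e' ; U = Instance.U I }

module Submission where

open import Defs
open import Data.Nat as ℕ using (ℕ)
open import Data.Bool using (Bool; true; false; _∧_; if_then_else_; T)
open import Data.Fin using (Fin)
open import Data.Integer using (+_)
open import Data.Rational
open import Relation.Binary.PropositionalEquality using (_≡_)

import Data.Nat.Properties as ℕ
import Data.Integer as ℤ
import Data.Integer.Properties as ℤ
import Data.Sign as Sign
open import Data.Nat.Coprimality using (1-coprimeTo) renaming (sym to coprime-sym)
open import Data.Product using (proj₁; proj₂)
open import Data.Unit using (tt)
open import Data.Rational.Properties
open import Algebra.Bundles using (CommutativeMonoid)
open CommutativeMonoid +-0-commutativeMonoid using (commutativeSemigroup)
open import Algebra.Properties.CommutativeSemigroup commutativeSemigroup using (interchange)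
open import Relation.Binary.PropositionalEquality using (refl; cong; cong₂; subst)
  renaming (sym to ≡-sym; trans to ≡-trans)

-- The greedy bound: every job of L is accepted with processing time at least Δ, so
-- |L| Δ is at most the accepted size, which is the total load of the m machines,
-- hence at most m Cmax ≤ m cost(π') ≤ m (1 + ε/2) Z* ≤ (1 + ε/2) m.  Rounding the
-- penalties only enters through their non-negativity.

+[1+n]/1≡1+n/1 : ∀ n → + ℕ.suc n / 1 ≡ 1ℚ + + n / 1
-- With + n / 1 in normal form, 1ℚ + + n / 1 computes to (1 + n * 1) / 1.
+[1+n]/1≡1+n/1 n = ≡-sym (≡-trans (cong (λ x → 1ℚ + x) n/1≡mkℚ) (cong (_/ 1) 1+n*1≡1+n))
  where
  n/1≡mkℚ : + n / 1 ≡ mkℚ (+ n) 0 (coprime-sym (1-coprimeTo n))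
  n/1≡mkℚ = normalize-coprime (coprime-sym (1-coprimeTo n))
  1+n*1≡1+n : + 1 ℤ.+ (Sign.+ ℤ.◃ n ℕ.* 1) ≡ + ℕ.suc n
  1+n*1≡1+n rewrite ℕ.*-identityʳ n | ℤ.+◃n≡+n n = refl

sumFin-cong : ∀ {n} {f g : Fin n → ℚ} → (∀ i → f i ≡ g i) → sumFin f ≡ sumFin g
sumFin-cong {ℕ.zero}  f≡g = refl
sumFin-cong {ℕ.suc n} f≡g = cong₂ _+_ (f≡g Fin.zero) (sumFin-cong (λ i → f≡g (Fin.suc i)))

sumFin-zero : ∀ n → sumFin {n} (λ _ → 0ℚ) ≡ 0ℚ
sumFin-zero ℕ.zero    = refl
sumFin-zero (ℕ.suc n) = ≡-trans (+-identityˡ _) (sumFin-zero n)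

sumFin-+ : ∀ {n} (f g : Fin n → ℚ) → sumFin (λ i → f i + g i) ≡ sumFin f + sumFin g
sumFin-+ {ℕ.zero}  f g = refl
sumFin-+ {ℕ.suc n} f g =
  ≡-trans (cong (λ x → f Fin.zero + g Fin.zero + x) (sumFin-+ (λ i → f (Fin.suc i)) (λ i → g (Fin.suc i))))
          (interchange (f Fin.zero) (g Fin.zero) _ _)

sumFin-comm : ∀ {n m} (h : Fin n → Fin m → ℚ) →
  sumFin (λ i → sumFin (λ j → h j i)) ≡ sumFin (λ j → sumFin (λ i → h j i))
sumFin-comm {ℕ.zero}  {m} h = sumFin-zero m
sumFin-comm {ℕ.suc n}     h =
  ≡-trans (sumFin-+ (h Fin.zero) (λ i → sumFin (λ j → h (Fin.suc j) i)))
          (cong (λ x → sumFin (h Fin.zero) + x) (sumFin-comm (λ j → h (Fin.suc j))))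

sumFin-indicator : ∀ {m} (c : Fin m) (x : ℚ) → sumFin (λ i → if c == i then x else 0ℚ) ≡ x
sumFin-indicator {ℕ.suc m} Fin.zero    x = ≡-trans (cong (λ y → x + y) (sumFin-zero m)) (+-identityʳ x)
sumFin-indicator {ℕ.suc m} (Fin.suc c) x = ≡-trans (+-identityˡ _) (sumFin-indicator c x)

sumFin-nonNeg : ∀ {n} (f : Fin n → ℚ) → (∀ j → 0ℚ ≤ f j) → 0ℚ ≤ sumFin f
sumFin-nonNeg {ℕ.zero}  f 0≤f = ≤-refl
sumFin-nonNeg {ℕ.suc n} f 0≤f =
  +-mono-≤ (0≤f Fin.zero) (sumFin-nonNeg (λ i → f (Fin.suc i)) (λ i → 0≤f (Fin.suc i)))

sumFin≤n*maxFin : ∀ {n} (f : Fin n → ℚ) → sumFin f ≤ (+ n / 1) * maxFin f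
sumFin≤n*maxFin {ℕ.zero}  f = ≤-refl
sumFin≤n*maxFin {ℕ.suc n} f = begin
    f Fin.zero + sumFin f′       ≤⟨ +-mono-≤ (p≤p⊔q (f Fin.zero) M′) tail≤n*M ⟩
    M + (+ n / 1) * M            ≡⟨ cong (_+ (+ n / 1) * M) (*-identityˡ M) ⟨
    1ℚ * M + (+ n / 1) * M       ≡⟨ *-distribʳ-+ M 1ℚ (+ n / 1) ⟨
    (1ℚ + + n / 1) * M           ≡⟨ cong (_* M) (+[1+n]/1≡1+n/1 n) ⟨
    (+ ℕ.suc n / 1) * M          ∎
  where
  open ≤-Reasoning
  f′ = λ i → f (Fin.suc i)
  M′ = maxFin f′
  M = f Fin.zero ⊔ M′
  tail≤n*M : sumFin f′ ≤ (+ n / 1) * M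
  tail≤n*M = ≤-trans (sumFin≤n*maxFin f′)
                     (*-monoˡ-≤-nonNeg (+ n / 1) {{normalize-nonNeg n 1}} (p≤q⊔p (f Fin.zero) M′))

countFin*≤sumFin : ∀ {n} (Δ : ℚ) (f : Fin n → ℚ) (b : Fin n → Bool) → (∀ j → 0ℚ ≤ f j)
  → (∀ j → b j ≡ true → Δ ≤ f j) → (+ countFin b / 1) * Δ ≤ sumFin f
countFin*≤sumFin {ℕ.zero}  Δ f b 0≤f Δ≤f = ≤-reflexive (*-zeroˡ Δ)
countFin*≤sumFin {ℕ.suc n} Δ f b 0≤f Δ≤f with b Fin.zero in b₀
... | true  = begin
    (+ ℕ.suc c / 1) * Δ          ≡⟨ cong (_* Δ) (+[1+n]/1≡1+n/1 c) ⟩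
    (1ℚ + + c / 1) * Δ           ≡⟨ *-distribʳ-+ Δ 1ℚ (+ c / 1) ⟩
    1ℚ * Δ + (+ c / 1) * Δ       ≡⟨ cong (_+ (+ c / 1) * Δ) (*-identityˡ Δ) ⟩
    Δ + (+ c / 1) * Δ            ≤⟨ +-mono-≤ (Δ≤f Fin.zero b₀) tail ⟩
    f Fin.zero + sumFin f′       ∎
  where
  open ≤-Reasoning
  f′ = λ i → f (Fin.suc i)
  c = countFin (λ i → b (Fin.suc i))
  tail = countFin*≤sumFin Δ f′ (λ i → b (Fin.suc i)) (λ i → 0≤f (Fin.suc i)) (λ i → Δ≤f (Fin.suc i))
... | false = ≤-trans (≤-reflexive (≡-sym (+-identityˡ _)))
    (+-mono-≤ (0≤f Fin.zero)
      (countFin*≤sumFin Δ (λ i → f (Fin.suc i)) (λ i → b (Fin.suc i))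
        (λ i → 0≤f (Fin.suc i)) (λ i → Δ≤f (Fin.suc i))))

module _ {n m : ℕ} (I : Instance n m) (σ : Solution n m) where
  open Instance I
  open Solution σ

  acceptedTime : Fin n → ℚ
  acceptedTime j = if accept j then p j else 0ℚ

  acceptedTime-nonNeg : (∀ j → 0ℚ ≤ p j) → ∀ j → 0ℚ ≤ acceptedTime j
  acceptedTime-nonNeg 0≤p j with accept j
  ... | true  = 0≤p j
  ... | false = ≤-refl

  jobLoad : Fin n → Fin m → ℚ
  jobLoad j i = if accept j then (if assign j == i then p j else 0ℚ) else 0ℚ

  sumFin-jobLoad : ∀ j → sumFin (jobLoad j) ≡ acceptedTime j
  sumFin-jobLoad j with accept j
  ... | true  = sumFin-indicator (assign j) (p j)
  ... | false = sumFin-zero m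

  sumFin-load≡acceptedSize : sumFin (load I σ) ≡ acceptedSize I σ
  sumFin-load≡acceptedSize = ≡-trans (sumFin-comm jobLoad) (sumFin-cong sumFin-jobLoad)

  Cmax≤cost : (∀ j → 0ℚ ≤ e j) → Cmax I σ ≤ cost I σ
  Cmax≤cost 0≤e = ≤-trans (≤-reflexive (≡-sym (+-identityʳ _)))
                          (+-monoʳ-≤ (Cmax I σ) (sumFin-nonNeg _ rejected-nonNeg))
    where
    rejected-nonNeg : ∀ j → 0ℚ ≤ (if accept j then 0ℚ else e j)
    rejected-nonNeg j with accept j
    ... | true  = ≤-refl
    ... | false = 0≤e j

  acceptedSize≤m*cost : (∀ j → 0ℚ ≤ e j) → acceptedSize I σ ≤ (+ m / 1) * cost I σ
  acceptedSize≤m*cost 0≤e = begin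
    acceptedSize I σ             ≡⟨ sumFin-load≡acceptedSize ⟨
    sumFin (load I σ)            ≤⟨ sumFin≤n*maxFin (load I σ) ⟩
    (+ m / 1) * Cmax I σ         ≤⟨ *-monoˡ-≤-nonNeg (+ m / 1) {{normalize-nonNeg m 1}} (Cmax≤cost 0≤e) ⟩
    (+ m / 1) * cost I σ         ∎
    where open ≤-Reasoning

roundedPenalty-nonNeg : ∀ (risky : Bool) {δ e e′ : ℚ} → (risky ≡ true → IsRoundUp δ e e′)
  → (risky ≡ false → e′ ≡ e) → 0ℚ ≤ e → 0ℚ ≤ e′
roundedPenalty-nonNeg true  roundUp _    0≤e = ≤-trans 0≤e (proj₁ (proj₂ (roundUp refl)))
roundedPenalty-nonNeg false _       same 0≤e = subst (0ℚ ≤_) (≡-sym (same refl)) 0≤e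

large⇒Δ≤acceptedTime : ∀ (Δ : ℚ) risky accepted (p : ℚ) →
  (risky ∧ accepted ∧ (Δ ≤ᵇ p)) ≡ true → Δ ≤ (if accepted then p else 0ℚ)
large⇒Δ≤acceptedTime Δ true true p large = ≤ᵇ⇒≤ (subst T (≡-sym large) tt)

lemma7 : (n m : ℕ) → .{{_ : ℕ.NonZero m}} → (I : Instance n m)
    → (∀ j → 0ℚ ≤ Instance.p I j) → (∀ j → 0ℚ ≤ Instance.e I j) → 0ℚ ≤ Instance.U I
    → (Z : ℚ) → IsOptimalCost I Z → ½ ≤ Z → Z ≤ 1ℚ
    → (k : ℕ) → .{{_ : ℕ.NonZero k}} → 2 ℕ.≤ k
    → let ε = + 1 / k
          Δ = ε * (+ 1 / (12 ℕ.+ 4 ℕ.* m))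
          δ = ε * Δ * ½
          risky = λ j → Δ ≤ᵇ Instance.e I j
      in (e' : Fin n → ℚ)
    → (∀ j → risky j ≡ true → IsRoundUp δ (Instance.e I j) (e' j))
    → (∀ j → risky j ≡ false → e' j ≡ Instance.e I j)
    → (π' : Solution n m) → Feasible (withPenalties I e') π'
    → cost (withPenalties I e') π' ≤ (1ℚ + ε * ½) * Z
    → let inL = λ j → risky j ∧ Solution.accept π' j ∧ (Δ ≤ᵇ Instance.p I j)
      in (+ countFin inL / 1) * Δ ≤ (1ℚ + ε * ½) * (+ m / 1)
lemma7 n m I 0≤p 0≤e _ Z _ _ Z≤1 k _ e' roundUp same π' _ cost≤ = begin
    (+ countFin inL / 1) * Δ     ≤⟨ countFin*≤sumFin Δ (acceptedTime I′ π') inL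
                                      (acceptedTime-nonNeg I′ π' 0≤p) large⇒Δ≤ ⟩
    acceptedSize I′ π'           ≤⟨ acceptedSize≤m*cost I′ π' 0≤e′ ⟩
    mq * cost I′ π'              ≤⟨ *-monoˡ-≤-nonNeg mq {{normalize-nonNeg m 1}} cost≤c ⟩
    mq * c                       ≡⟨ *-comm mq c ⟩
    c * mq                       ∎
  where
  open ≤-Reasoning
  ε = + 1 / k
  Δ = ε * (+ 1 / (12 ℕ.+ 4 ℕ.* m))
  c = 1ℚ + ε * ½
  mq = + m / 1
  risky = λ j → Δ ≤ᵇ Instance.e I j
  inL = λ j → risky j ∧ Solution.accept π' j ∧ (Δ ≤ᵇ Instance.p I j)
  I′ = withPenalties I e'
  large⇒Δ≤ : ∀ j → inL j ≡ true → Δ ≤ acceptedTime I′ π' j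
  large⇒Δ≤ j = large⇒Δ≤acceptedTime Δ (risky j) (Solution.accept π' j) (Instance.p I j)
  0≤e′ : ∀ j → 0ℚ ≤ e' j
  0≤e′ j = roundedPenalty-nonNeg (risky j) (roundUp j) (same j) (0≤e j)
  cost≤c : cost I′ π' ≤ c
  cost≤c = ≤-trans cost≤ (≤-trans
    (*-monoˡ-≤-nonNeg c {{nonNeg+nonNeg⇒nonNeg 1ℚ (ε * ½) {{nonNeg*nonNeg⇒nonNeg ε {{normalize-nonNeg 1 k}} ½}}}} Z≤1)
    (≤-reflexive (*-identityʳ c)))
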